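{- There exists $n_0$ such that for every integer $n\ge n_0$, $\mu_{\rm o}(L(K_n))=\left\lceil\frac n2\right\rceil\cdot\left\lfloor\frac n2\right\rfloor$.
   Context: $L(K_n)$ is the line graph of the complete graph $K_n$. For a connected graph $H$ and $X\subseteq V(H)$, two vertices are $X$-visible if there is a shortest path between them whose internal vertices are not in $X$; $X$ is an outer mutual-visibility set if every two vertices of $X$ are $X$-visible and every $x\in X$, $y\in V(H)\setminus X$ are $X$-visible, and $\mu_{\rm o}(H)$ is the maximum cardinality of such a set. -}

module Defs where

open import Data.Nat using (ℕ; zero; suc; _≤_)
open import Data.Fin using (Fin)
import Data.Fin as F
open import Data.List using (List; []; _∷_; length)
open import Data.List.Membership.Propositional using (_∈_)
open import Data.List.Relation.Unary.All using (All)
open import Data.List.Relation.Unary.Unique.Propositional using (Unique)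
open import Data.Product using (Σ; _×_; ∃; proj₁; proj₂)
open import Data.Sum using (_⊎_)
open import Relation.Binary.PropositionalEquality using (_≡_; _≢_)
open import Relation.Nullary using (¬_)

record Graph : Set₁ where
  field
    V   : Set
    Adj : V → V → Set

module _ (G : Graph) where
  open Graph G

  data Walk : V → V → Set where
    []  : ∀ {u} → Walk u u
    _∷_ : ∀ {u w v} → Adj u w → Walk w v → Walk u v

  len : ∀ {u v} → Walk u v → ℕ
  len []      = zero
  len (_ ∷ p) = suc (len p)

  internal : ∀ {u v} → Walk u v → List V
  internal []                     = []
  internal (_ ∷ [])               = []
  internal (_∷_ {w = w} _ (e ∷ p)) = w ∷ internal (e ∷ p)

  IsShortest : ∀ {u v} → Walk u v → Set
  IsShortest {u} {v} p = (q : Walk u v) → len p ≤ len q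

  Visible : List V → V → V → Set
  Visible X u v = Σ (Walk u v) λ p → IsShortest p × All (λ z → ¬ (z ∈ X)) (internal p)

  OuterMV : List V → Set
  OuterMV X = (∀ x y → x ∈ X → y ∈ X → Visible X x y)
            × (∀ x y → x ∈ X → ¬ (y ∈ X) → Visible X x y)

  IsMuO : ℕ → Set
  IsMuO m = (Σ (List V) λ X → Unique X × OuterMV X × length X ≡ m)
          × (∀ (X : List V) → Unique X → OuterMV X → length X ≤ m)

-- Line graph of K_n: vertices are edges {i,j} of K_n, encoded as pairs i < j;
-- two distinct such edges are adjacent iff they share an endpoint.
LKVertex : ℕ → Set
LKVertex n = Σ (Fin n) λ i → Σ (Fin n) λ j → i F.< j

LKAdj : ∀ n → LKVertex n → LKVertex n → Set
LKAdj n e f = e ≢ f ×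
  ( (proj₁ e ≡ proj₁ f) ⊎ (proj₁ e ≡ proj₁ (proj₂ f))
  ⊎ (proj₁ (proj₂ e) ≡ proj₁ f) ⊎ (proj₁ (proj₂ e) ≡ proj₁ (proj₂ f)))

LK : ℕ → Graph
LK n = record { V = LKVertex n ; Adj = LKAdj n }

-- The edges of an outer mutual-visibility set X of L(Kₙ) form a graph on n vertices with no
-- diamond (edges ab, ac, ad, bc, bd with c ≠ d): otherwise ab and cd are at distance 2 in
-- L(Kₙ) and each of their common neighbours, an edge from {a, b} to {c, d}, lies in X, so ab
-- cannot see cd. A diamond-free graph on n ≥ 4 vertices has at most ⌈n/2⌉⌊n/2⌋ edges: delete the
-- vertices of a triangle (or, if there is none, the ends of an edge, as in Mantel's theorem);
-- every other vertex sends at most one edge into the deleted set, and induction finishes the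
-- count. Conversely the edges of K_{⌈n/2⌉,⌊n/2⌋} are such a set: two disjoint edges have ends on
-- a common side, and the edge joining those ends is not in the set.
module Submission where

open import Defs
open import Data.Empty using (⊥; ⊥-elim)
open import Data.Fin using (Fin; toℕ; _↑ˡ_; _↑ʳ_; remQuot; combine)
open import Data.Fin.Properties
  using (_≟_; <-cmp; toℕ<n; toℕ-↑ˡ; toℕ-↑ʳ; ↑ˡ-injective; ↑ʳ-injective; combine-remQuot)
open import Data.List using (List; []; _∷_; length; _++_; filter; allFin; tabulate)
open import Data.List.Properties using (length-tabulate)
import Data.List.Membership.DecPropositional as DecMembership
open import Data.List.Membership.Propositional using (_∈_; _∉_; find; lose)
open import Data.List.Membership.Propositional.Properties
  using (∈-∃++; ∈-++⁻; ∈-++⁺ˡ; ∈-++⁺ʳ; ∈-filter⁺; ∈-filter⁻; ∈-allFin; ∈-tabulate⁻)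
open import Data.List.Relation.Binary.Permutation.Propositional.Properties using (↭-length; shift)
open import Data.List.Relation.Binary.Subset.Propositional using (_⊆_)
open import Data.List.Relation.Unary.All as All using (All; []; _∷_)
open import Data.List.Relation.Unary.AllPairs using ([]; _∷_)
open import Data.List.Relation.Unary.Any using (here; there; any?)
open import Data.List.Relation.Unary.Unique.Propositional using (Unique)
import Data.List.Relation.Unary.Unique.Propositional.Properties as Unique
open import Data.Nat using (ℕ; suc; _+_; _*_; _≤_; _<_; z≤n; s≤s; ⌊_/2⌋; ⌈_/2⌉; _<?_)
open import Data.Nat.Induction using (<-wellFounded)
open import Data.Nat.Properties hiding (_≟_; <-cmp)
open import Data.Product using (Σ; ∃; _×_; _,_; proj₁; proj₂; uncurry)
open import Data.Product.Properties using (≡-dec)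
open import Data.Sum using (_⊎_; inj₁; inj₂)
open import Function using (id; _∘_)
open import Induction.WellFounded using (Acc; acc)
open import Relation.Binary using (DecidableEquality; tri<; tri≈; tri>)
open import Relation.Binary.PropositionalEquality
open import Relation.Nullary using (¬_; Dec; yes; no; contradiction)
open import Relation.Nullary.Decidable using (_⊎-dec_; _×-dec_; map′)
open import Relation.Unary using (Decidable)
open import Relation.Unary.Properties using (∁?)

module _ {A B : Set} where

  injective-length-≤ : (f : A → B) {xs : List A} {ys : List B} → Unique xs →
                       (∀ {x} → x ∈ xs → f x ∈ ys) →
                       (∀ {x y} → x ∈ xs → y ∈ xs → f x ≡ f y → x ≡ y) →
                       length xs ≤ length ys
  injective-length-≤ f {[]}     _            _    _   = z≤n
  injective-length-≤ f {x ∷ xs} (x≢xs ∷ uxs) into inj with ∈-∃++ (into (here refl))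
  ... | as , bs , refl = begin
    suc (length xs)          ≤⟨ s≤s (injective-length-≤ f uxs into′ (λ p q → inj (there p) (there q))) ⟩
    suc (length (as ++ bs))  ≡⟨ ↭-length (shift (f x) as bs) ⟨
    length (as ++ f x ∷ bs)  ∎
    where
    open ≤-Reasoning
    into′ : ∀ {y} → y ∈ xs → f y ∈ as ++ bs
    into′ y∈xs with ∈-++⁻ as (into (there y∈xs))
    ... | inj₁ p         = ∈-++⁺ˡ p
    ... | inj₂ (here eq) = contradiction (sym (inj (there y∈xs) (here refl) eq)) (All.lookup x≢xs y∈xs)
    ... | inj₂ (there p) = ∈-++⁺ʳ as p

module _ {A : Set} where

  ⊆-length-≤ : {xs ys : List A} → Unique xs → xs ⊆ ys → length xs ≤ length ys
  ⊆-length-≤ uxs xs⊆ys = injective-length-≤ id uxs xs⊆ys (λ _ _ eq → eq)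

  length-filter+length-filter-∁ : {P : A → Set} (P? : Decidable P) (xs : List A) →
                                  length (filter P? xs) + length (filter (∁? P?) xs) ≡ length xs
  length-filter+length-filter-∁ P? []       = refl
  length-filter+length-filter-∁ P? (x ∷ xs) with P? x
  ... | yes _ = cong suc (length-filter+length-filter-∁ P? xs)
  ... | no  _ = trans (+-suc _ _) (cong suc (length-filter+length-filter-∁ P? xs))

  third-of-three : ∀ {a b c s t : A} → Unique (a ∷ b ∷ c ∷ []) →
                   s ∈ a ∷ b ∷ c ∷ [] → t ∈ a ∷ b ∷ c ∷ [] → s ≢ t →
                   Σ A λ r → r ∈ a ∷ b ∷ c ∷ [] × s ≢ r × t ≢ r
  third-of-three {a} {b} {c} ((a≢b ∷ a≢c ∷ []) ∷ (b≢c ∷ []) ∷ [] ∷ []) = pick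
    where
    pick : ∀ {s t} → s ∈ a ∷ b ∷ c ∷ [] → t ∈ a ∷ b ∷ c ∷ [] → s ≢ t →
           Σ A λ r → r ∈ a ∷ b ∷ c ∷ [] × s ≢ r × t ≢ r
    pick (here refl)                 (here refl)                 s≢s = contradiction refl s≢s
    pick (here refl)                 (there (here refl))         _   = c , there (there (here refl)) , a≢c , b≢c
    pick (here refl)                 (there (there (here refl))) _   = b , there (here refl) , a≢b , b≢c ∘ sym
    pick (there (here refl))         (here refl)                 _   = c , there (there (here refl)) , b≢c , a≢c
    pick (there (here refl))         (there (here refl))         s≢s = contradiction refl s≢s
    pick (there (here refl))         (there (there (here refl))) _   = a , here refl , a≢b ∘ sym , a≢c ∘ sym
    pick (there (there (here refl))) (here refl)                 _   = b , there (here refl) , b≢c ∘ sym , a≢b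
    pick (there (there (here refl))) (there (here refl))         _   = a , here refl , a≢c ∘ sym , a≢b ∘ sym
    pick (there (there (here refl))) (there (there (here refl))) s≢s = contradiction refl s≢s

-- The extremal functions

quarterSquare : ℕ → ℕ
quarterSquare n = ⌈ n /2⌉ * ⌊ n /2⌋

quarterSquare-suc : ∀ s → quarterSquare (suc s) ≡ ⌈ s /2⌉ + quarterSquare s
quarterSquare-suc s = trans (*-comm (suc ⌊ s /2⌋) ⌈ s /2⌉) (*-suc ⌈ s /2⌉ ⌊ s /2⌋)

quarterSquare-suc-suc : ∀ s → quarterSquare (2 + s) ≡ suc s + quarterSquare s
quarterSquare-suc-suc s = begin
  quarterSquare (2 + s)                     ≡⟨ quarterSquare-suc (suc s) ⟩
  ⌈ suc s /2⌉ + quarterSquare (suc s)       ≡⟨ cong (⌈ suc s /2⌉ +_) (quarterSquare-suc s) ⟩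
  ⌈ suc s /2⌉ + (⌈ s /2⌉ + quarterSquare s) ≡⟨ +-assoc ⌈ suc s /2⌉ ⌈ s /2⌉ (quarterSquare s) ⟨
  suc (⌊ s /2⌋ + ⌈ s /2⌉) + quarterSquare s ≡⟨ cong (λ k → suc k + quarterSquare s) (⌊n/2⌋+⌈n/2⌉≡n s) ⟩
  suc s + quarterSquare s                   ∎
  where open ≡-Reasoning

-- The maximal number of edges of a diamond-free graph on n vertices: the triangle beats ⌊n²/4⌋ at n = 3.
diamondBound : ℕ → ℕ
diamondBound 3 = 3
diamondBound n = quarterSquare n

quarterSquare≤diamondBound : ∀ n → quarterSquare n ≤ diamondBound n
quarterSquare≤diamondBound 0                         = ≤-refl
quarterSquare≤diamondBound 1                         = ≤-refl
quarterSquare≤diamondBound 2                         = ≤-refl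
quarterSquare≤diamondBound 3                         = n≤1+n 2
quarterSquare≤diamondBound (suc (suc (suc (suc _)))) = ≤-refl

diamondBound-≥4 : ∀ {n} → 4 ≤ n → diamondBound n ≡ quarterSquare n
diamondBound-≥4 (s≤s (s≤s (s≤s (s≤s _)))) = refl

quarterSquare-peel-edge : ∀ t → quarterSquare t + 1 + t ≤ quarterSquare (2 + t)
quarterSquare-peel-edge t = ≤-reflexive (begin
  quarterSquare t + 1 + t  ≡⟨ +-assoc (quarterSquare t) 1 t ⟩
  quarterSquare t + suc t  ≡⟨ +-comm (quarterSquare t) (suc t) ⟩
  suc t + quarterSquare t  ≡⟨ quarterSquare-suc-suc t ⟨
  quarterSquare (2 + t)    ∎)
  where open ≡-Reasoning

quarterSquare-peel-triangle : ∀ t → 1 ≤ t → quarterSquare t + 3 + t ≤ quarterSquare (3 + t)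
quarterSquare-peel-triangle t 1≤t = begin
  quarterSquare t + 3 + t              ≡⟨ +-assoc (quarterSquare t) 3 t ⟩
  quarterSquare t + (3 + t)            ≡⟨ cong (quarterSquare t +_) (+-comm 1 (2 + t)) ⟩
  quarterSquare t + (2 + t + 1)        ≤⟨ +-monoʳ-≤ (quarterSquare t) (+-monoʳ-≤ (2 + t) (⌈n/2⌉-mono 1≤t)) ⟩
  quarterSquare t + (2 + t + ⌈ t /2⌉)  ≡⟨ +-comm (quarterSquare t) (2 + t + ⌈ t /2⌉) ⟩
  2 + t + ⌈ t /2⌉ + quarterSquare t    ≡⟨ +-assoc (2 + t) ⌈ t /2⌉ (quarterSquare t) ⟩
  2 + t + (⌈ t /2⌉ + quarterSquare t)  ≡⟨ cong (2 + t +_) (quarterSquare-suc t) ⟨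
  2 + t + quarterSquare (suc t)        ≡⟨ quarterSquare-suc-suc (suc t) ⟨
  quarterSquare (3 + t)                ∎
  where open ≤-Reasoning

diamondBound-peel-triangle : ∀ t → diamondBound t + 3 + t ≤ diamondBound (3 + t)
diamondBound-peel-triangle 0                           = ≤-refl
diamondBound-peel-triangle 1                           = ≤-refl
diamondBound-peel-triangle 2                           = ≤-refl
diamondBound-peel-triangle 3                           = ≤-refl
diamondBound-peel-triangle t@(suc (suc (suc (suc _)))) = quarterSquare-peel-triangle t (s≤s z≤n)

peel-bound : ∀ (B : ℕ → ℕ) {k l s r x} → (∀ t → B t + l + t ≤ B (k + t)) →
             r ≤ B s → x ≤ r + l + s → x ≤ B (k + s)
peel-bound B {k} {l} {s} {r} {x} B-peel r≤ x≤ = begin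
  x            ≤⟨ x≤ ⟩
  r + l + s    ≤⟨ +-monoˡ-≤ s (+-monoˡ-≤ l r≤) ⟩
  B s + l + s  ≤⟨ B-peel s ⟩
  B (k + s)    ∎
  where open ≤-Reasoning

-- Edges of Kₙ

Edge : ℕ → Set
Edge = LKVertex

module _ {n : ℕ} where

  lo hi : Edge n → Fin n
  lo = proj₁
  hi = proj₁ ∘ proj₂

  lo≢hi : ∀ e → lo e ≢ hi e
  lo≢hi (_ , _ , lo<hi) = <⇒≢ lo<hi ∘ cong toℕ

  _≟ₑ_ : DecidableEquality (Edge n)
  _≟ₑ_ = ≡-dec _≟_ (≡-dec _≟_ (λ p q → yes (<-irrelevant p q)))

  data Incident (e : Edge n) : Fin n → Set where
    lo-incident : Incident e (lo e)
    hi-incident : Incident e (hi e)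

  data Ends (e : Edge n) : Fin n → Fin n → Set where
    lo-hi : Ends e (lo e) (hi e)
    hi-lo : Ends e (hi e) (lo e)

  module _ {e : Edge n} where

    Ends-sym : ∀ {x y} → Ends e x y → Ends e y x
    Ends-sym lo-hi = hi-lo
    Ends-sym hi-lo = lo-hi

    Ends⇒≢ : ∀ {x y} → Ends e x y → x ≢ y
    Ends⇒≢ lo-hi = lo≢hi e
    Ends⇒≢ hi-lo = lo≢hi e ∘ sym

    Ends⇒Incidentˡ : ∀ {x y} → Ends e x y → Incident e x
    Ends⇒Incidentˡ lo-hi = lo-incident
    Ends⇒Incidentˡ hi-lo = hi-incident

    Ends⇒Incidentʳ : ∀ {x y} → Ends e x y → Incident e y
    Ends⇒Incidentʳ = Ends⇒Incidentˡ ∘ Ends-sym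

    Incident⇒Ends : ∀ {x y} → Incident e x → Incident e y → x ≢ y → Ends e x y
    Incident⇒Ends lo-incident lo-incident x≢x = contradiction refl x≢x
    Incident⇒Ends lo-incident hi-incident _   = lo-hi
    Incident⇒Ends hi-incident lo-incident _   = hi-lo
    Incident⇒Ends hi-incident hi-incident x≢x = contradiction refl x≢x

    Ends-Incident⇒≡ : ∀ {x y z} → Ends e x y → Incident e z → z ≡ x ⊎ z ≡ y
    Ends-Incident⇒≡ lo-hi lo-incident = inj₁ refl
    Ends-Incident⇒≡ lo-hi hi-incident = inj₂ refl
    Ends-Incident⇒≡ hi-lo lo-incident = inj₂ refl
    Ends-Incident⇒≡ hi-lo hi-incident = inj₁ refl

  Ends-unique : ∀ {e f x y} → Ends e x y → Ends f x y → e ≡ f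
  Ends-unique {i , j , p} {_ , _ , q} lo-hi lo-hi = cong (λ r → i , j , r) (<-irrelevant p q)
  Ends-unique {_ , _ , p} {_ , _ , q} lo-hi hi-lo = contradiction (<-trans p q) (<-irrefl refl)
  Ends-unique {_ , _ , p} {_ , _ , q} hi-lo lo-hi = contradiction (<-trans p q) (<-irrefl refl)
  Ends-unique {i , j , p} {_ , _ , q} hi-lo hi-lo = cong (λ r → i , j , r) (<-irrelevant p q)

  edgeBetween : ∀ x y → x ≢ y → Σ (Edge n) λ e → Ends e x y
  edgeBetween x y x≢y with <-cmp x y
  ... | tri< x<y _ _ = (x , y , x<y) , lo-hi
  ... | tri≈ _ x≡y _ = contradiction x≡y x≢y
  ... | tri> _ _ y<x = (y , x , y<x) , hi-lo

  ends? : ∀ e x y → Dec (Ends e x y)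
  ends? e x y = map′ fromEqs toEqs ((lo e ≟ x ×-dec hi e ≟ y) ⊎-dec (lo e ≟ y ×-dec hi e ≟ x))
    where
    fromEqs : (lo e ≡ x × hi e ≡ y) ⊎ (lo e ≡ y × hi e ≡ x) → Ends e x y
    fromEqs (inj₁ (refl , refl)) = lo-hi
    fromEqs (inj₂ (refl , refl)) = hi-lo
    toEqs : Ends e x y → (lo e ≡ x × hi e ≡ y) ⊎ (lo e ≡ y × hi e ≡ x)
    toEqs lo-hi = inj₁ (refl , refl)
    toEqs hi-lo = inj₂ (refl , refl)

  Joins : List (Edge n) → Fin n → Fin n → Set
  Joins X x y = Σ (Edge n) λ e → e ∈ X × Ends e x y

  module _ {X : List (Edge n)} {x y : Fin n} where

    Joins-sym : Joins X x y → Joins X y x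
    Joins-sym (e , e∈X , ends) = e , e∈X , Ends-sym ends

    Joins⇒≢ : Joins X x y → x ≢ y
    Joins⇒≢ (_ , _ , ends) = Ends⇒≢ ends

    Joins-mono : ∀ {Y} → X ⊆ Y → Joins X x y → Joins Y x y
    Joins-mono X⊆Y (e , e∈X , ends) = e , X⊆Y e∈X , ends

  joins? : ∀ X x y → Dec (Joins X x y)
  joins? X x y = map′ find (λ (e , e∈X , ends) → lose e∈X ends) (any? (λ e → ends? e x y) X)

-- Distances in L(Kₙ)

module _ {n : ℕ} where

  Disjoint : Edge n → Edge n → Set
  Disjoint e f = ∀ {x} → Incident e x → Incident f x → ⊥

  adjacent⇒shared : ∀ {e f} → LKAdj n e f → Σ (Fin n) λ x → Incident e x × Incident f x
  adjacent⇒shared {f = f} (_ , inj₁ eq)               = _ , lo-incident , subst (Incident f) (sym eq) lo-incident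
  adjacent⇒shared {f = f} (_ , inj₂ (inj₁ eq))        = _ , lo-incident , subst (Incident f) (sym eq) hi-incident
  adjacent⇒shared {f = f} (_ , inj₂ (inj₂ (inj₁ eq))) = _ , hi-incident , subst (Incident f) (sym eq) lo-incident
  adjacent⇒shared {f = f} (_ , inj₂ (inj₂ (inj₂ eq))) = _ , hi-incident , subst (Incident f) (sym eq) hi-incident

  shared⇒adjacent : ∀ {e f x} → e ≢ f → Incident e x → Incident f x → LKAdj n e f
  shared⇒adjacent {_ , _ , _} {_ , _ , _} e≢f lo-incident lo-incident = e≢f , inj₁ refl
  shared⇒adjacent {_ , _ , _} {_ , _ , _} e≢f lo-incident hi-incident = e≢f , inj₂ (inj₁ refl)
  shared⇒adjacent {_ , _ , _} {_ , _ , _} e≢f hi-incident lo-incident = e≢f , inj₂ (inj₂ (inj₁ refl))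
  shared⇒adjacent {_ , _ , _} {_ , _ , _} e≢f hi-incident hi-incident = e≢f , inj₂ (inj₂ (inj₂ refl))

  shared-or-disjoint : ∀ e f → (Σ (Fin n) λ x → Incident e x × Incident f x) ⊎ Disjoint e f
  shared-or-disjoint (i , j , _) (k , l , _) with i ≟ k | i ≟ l | j ≟ k | j ≟ l
  ... | yes refl | _        | _        | _        = inj₁ (i , lo-incident , lo-incident)
  ... | _        | yes refl | _        | _        = inj₁ (i , lo-incident , hi-incident)
  ... | _        | _        | yes refl | _        = inj₁ (j , hi-incident , lo-incident)
  ... | _        | _        | _        | yes refl = inj₁ (j , hi-incident , hi-incident)
  ... | no i≢k   | no i≢l   | no j≢k   | no j≢l   = inj₂ λ where
    lo-incident lo-incident → i≢k refl
    lo-incident hi-incident → i≢l refl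
    hi-incident lo-incident → j≢k refl
    hi-incident hi-incident → j≢l refl

  equal-adjacent-or-disjoint : ∀ e f → e ≡ f ⊎ LKAdj n e f ⊎ Disjoint e f
  equal-adjacent-or-disjoint e f with e ≟ₑ f | shared-or-disjoint e f
  ... | yes e≡f | _                    = inj₁ e≡f
  ... | no e≢f  | inj₁ (_ , e∋x , f∋x) = inj₂ (inj₁ (shared⇒adjacent e≢f e∋x f∋x))
  ... | no _    | inj₂ e∥f             = inj₂ (inj₂ e∥f)

  module _ {X : List (Edge n)} where

    visible-refl : ∀ {e} → Visible (LK n) X e e
    visible-refl = [] , (λ _ → z≤n) , []

    visible-adjacent : ∀ {e f} → LKAdj n e f → Visible (LK n) X e f
    visible-adjacent {e} {f} e~f = e~f ∷ [] , 1≤len , []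
      where
      1≤len : (w : Walk (LK n) e f) → 1 ≤ len (LK n) w
      1≤len []      = contradiction refl (proj₁ e~f)
      1≤len (_ ∷ _) = s≤s z≤n

  module _ {e f : Edge n} (e∥f : Disjoint e f) where

    Disjoint⇒≢ : ∀ {x y} → Incident e x → Incident f y → x ≢ y
    Disjoint⇒≢ e∋x f∋y refl = e∥f e∋x f∋y

    Disjoint⇒2≤len : (w : Walk (LK n) e f) → 2 ≤ len (LK n) w
    Disjoint⇒2≤len []          = ⊥-elim (e∥f lo-incident lo-incident)
    Disjoint⇒2≤len (e~f ∷ [])  = let _ , e∋x , f∋x = adjacent⇒shared e~f in ⊥-elim (e∥f e∋x f∋x)
    Disjoint⇒2≤len (_ ∷ _ ∷ _) = s≤s (s≤s z≤n)

    common-neighbour : ∀ {x y} → Incident e x → Incident f y →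
                       Σ (Edge n) λ m → Ends m x y × LKAdj n e m × LKAdj n m f
    common-neighbour {x} {y} e∋x f∋y with edgeBetween x y (Disjoint⇒≢ e∋x f∋y)
    ... | m , m-ends = m , m-ends , shared⇒adjacent e≢m e∋x (Ends⇒Incidentˡ m-ends)
                                  , shared⇒adjacent m≢f (Ends⇒Incidentʳ m-ends) f∋y
      where
      e≢m : e ≢ m
      e≢m refl = e∥f (Ends⇒Incidentʳ m-ends) f∋y
      m≢f : m ≢ f
      m≢f refl = e∥f e∋x (Ends⇒Incidentˡ m-ends)

    visible-through : ∀ {X x y} → Incident e x → Incident f y → (∀ {m} → Ends m x y → m ∉ X) →
                      Visible (LK n) X e f
    visible-through e∋x f∋y ends∉X with common-neighbour e∋x f∋y
    ... | m , m-ends , e~m , m~f = e~m ∷ m~f ∷ [] , Disjoint⇒2≤len , ends∉X m-ends ∷ []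

    ¬visible-through : ∀ {X} → (∀ {x y m} → Incident e x → Incident f y → Ends m x y → m ∈ X) →
                       ¬ Visible (LK n) X e f
    ¬visible-through {X} ends∈X (w , shortest , internal∉X) = go w shortest internal∉X
      where
      go : (w : Walk (LK n) e f) → IsShortest (LK n) w → All (_∉ X) (internal (LK n) w) → ⊥
      go []         _ _ with () ← Disjoint⇒2≤len []
      go (e~f ∷ []) _ _ with s≤s () ← Disjoint⇒2≤len (e~f ∷ [])
      go (e~m ∷ m~f ∷ []) _ (m∉X ∷ []) with adjacent⇒shared e~m | adjacent⇒shared m~f
      ... | _ , e∋x , m∋x | _ , m∋y , f∋y =
        m∉X (ends∈X e∋x f∋y (Incident⇒Ends m∋x m∋y (Disjoint⇒≢ e∋x f∋y)))
      go (_ ∷ _ ∷ _ ∷ _) shortest _ with common-neighbour {lo e} {lo f} lo-incident lo-incident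
      ... | _ , _ , e~m , m~f with shortest (e~m ∷ m~f ∷ [])
      ... | s≤s (s≤s ())

-- Diamond-free edge sets

module _ {n : ℕ} where

  TriangleFree : List (Edge n) → Set
  TriangleFree X = ∀ {a b c} → Joins X a b → Joins X a c → Joins X b c → ⊥

  DiamondFree : List (Edge n) → Set
  DiamondFree X = ∀ {a b c d} → c ≢ d →
                  Joins X a b → Joins X a c → Joins X a d → Joins X b c → Joins X b d → ⊥

  TriangleFree-⊆ : ∀ {X Y} → Y ⊆ X → TriangleFree X → TriangleFree Y
  TriangleFree-⊆ Y⊆X tf ab ac bc = tf (Joins-mono Y⊆X ab) (Joins-mono Y⊆X ac) (Joins-mono Y⊆X bc)

  DiamondFree-⊆ : ∀ {X Y} → Y ⊆ X → DiamondFree X → DiamondFree Y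
  DiamondFree-⊆ Y⊆X df c≢d ab ac ad bc bd =
    df c≢d (Joins-mono Y⊆X ab) (Joins-mono Y⊆X ac) (Joins-mono Y⊆X ad) (Joins-mono Y⊆X bc) (Joins-mono Y⊆X bd)

  triangle-or-free : ∀ X → (Σ (Edge n) λ e → e ∈ X × Σ (Fin n) λ w → Joins X (lo e) w × Joins X (hi e) w)
                         ⊎ TriangleFree X
  triangle-or-free X with any? (λ e → any? (λ w → joins? X (lo e) w ×-dec joins? X (hi e) w) (allFin n)) X
  ... | yes triangle = let e , e∈X , apex = find triangle
                           w , _ , ew   = find apex
                       in inj₁ (e , e∈X , w , ew)
  ... | no ¬triangle = inj₂ λ (e , e∈X , e-ends) ac bc →
                         ¬triangle (lose e∈X (lose (∈-allFin _) (apex e-ends ac bc)))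
    where
    apex : ∀ {e a b c} → Ends e a b → Joins X a c → Joins X b c → Joins X (lo e) c × Joins X (hi e) c
    apex lo-hi ac bc = ac , bc
    apex hi-lo ac bc = bc , ac

  outerMV⇒diamondFree : ∀ {X} → OuterMV (LK n) X → DiamondFree X
  outerMV⇒diamondFree {X} (visible∈ , visible∉) {c = c} {d} c≢d (e , e∈X , e-ends) ac ad bc bd =
    ¬visible-through e∥f ends∈X visible
    where
    f = proj₁ (edgeBetween c d c≢d)
    f-ends = proj₂ (edgeBetween c d c≢d)

    across : ∀ {x y} → Incident e x → Incident f y → Joins X x y
    across e∋x f∋y with Ends-Incident⇒≡ e-ends e∋x | Ends-Incident⇒≡ f-ends f∋y
    ... | inj₁ refl | inj₁ refl = ac
    ... | inj₁ refl | inj₂ refl = ad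
    ... | inj₂ refl | inj₁ refl = bc
    ... | inj₂ refl | inj₂ refl = bd

    e∥f : Disjoint e f
    e∥f e∋x f∋x = Joins⇒≢ (across e∋x f∋x) refl

    ends∈X : ∀ {x y m} → Incident e x → Incident f y → Ends m x y → m ∈ X
    ends∈X e∋x f∋y m-ends with across e∋x f∋y
    ... | g , g∈X , g-ends = subst (_∈ X) (Ends-unique g-ends m-ends) g∈X

    visible : Visible (LK n) X e f
    visible with DecMembership._∈?_ _≟ₑ_ f X
    ... | yes f∈X = visible∈ e f e∈X f∈X
    ... | no  f∉X = visible∉ e f e∈X f∉X

  VerticesIn : List (Fin n) → List (Edge n) → Set
  VerticesIn S X = ∀ {e x} → e ∈ X → Incident e x → x ∈ S

  CompleteOn : List (Fin n) → List (Edge n) → Set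
  CompleteOn T L = ∀ {x y} → x ∈ T → y ∈ T → x ≢ y → Joins L x y

  AtMostOneNeighbourIn : List (Fin n) → List (Edge n) → Set
  AtMostOneNeighbourIn T X = ∀ {w s t} → w ∉ T → s ∈ T → t ∈ T → s ≢ t → Joins X w s → Joins X w t → ⊥

  CompleteOn-edge : ∀ {L a b} → Joins L a b → CompleteOn (a ∷ b ∷ []) L
  CompleteOn-edge ab (here refl)         (here refl)         x≢x = contradiction refl x≢x
  CompleteOn-edge ab (here refl)         (there (here refl)) _   = ab
  CompleteOn-edge ab (there (here refl)) (here refl)         _   = Joins-sym ab
  CompleteOn-edge ab (there (here refl)) (there (here refl)) x≢x = contradiction refl x≢x

  CompleteOn-triangle : ∀ {L a b c} → Joins L a b → Joins L a c → Joins L b c → CompleteOn (a ∷ b ∷ c ∷ []) L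
  CompleteOn-triangle ab ac bc (here refl)                 (here refl)                 x≢x = contradiction refl x≢x
  CompleteOn-triangle ab ac bc (here refl)                 (there (here refl))         _   = ab
  CompleteOn-triangle ab ac bc (here refl)                 (there (there (here refl))) _   = ac
  CompleteOn-triangle ab ac bc (there (here refl))         (here refl)                 _   = Joins-sym ab
  CompleteOn-triangle ab ac bc (there (here refl))         (there (here refl))         x≢x = contradiction refl x≢x
  CompleteOn-triangle ab ac bc (there (here refl))         (there (there (here refl))) _   = bc
  CompleteOn-triangle ab ac bc (there (there (here refl))) (here refl)                 _   = Joins-sym ac
  CompleteOn-triangle ab ac bc (there (there (here refl))) (there (here refl))         _   = Joins-sym bc
  CompleteOn-triangle ab ac bc (there (there (here refl))) (there (there (here refl))) x≢x = contradiction refl x≢x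

  TriangleFree⇒AtMostOneNeighbourIn : ∀ {T X} → TriangleFree X → CompleteOn T X → AtMostOneNeighbourIn T X
  TriangleFree⇒AtMostOneNeighbourIn tf T-complete _ s∈T t∈T s≢t ws wt =
    tf (T-complete s∈T t∈T s≢t) (Joins-sym ws) (Joins-sym wt)

  DiamondFree⇒AtMostOneNeighbourIn : ∀ {a b c X} → DiamondFree X → Unique (a ∷ b ∷ c ∷ []) →
                                     CompleteOn (a ∷ b ∷ c ∷ []) X → AtMostOneNeighbourIn (a ∷ b ∷ c ∷ []) X
  DiamondFree⇒AtMostOneNeighbourIn df uT T-complete w∉T s∈T t∈T s≢t ws wt =
    let r , r∈T , s≢r , t≢r = third-of-three uT s∈T t∈T s≢t
    in df (λ { refl → w∉T r∈T }) (T-complete s∈T t∈T s≢t) (T-complete s∈T r∈T s≢r) (Joins-sym ws)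
          (T-complete t∈T r∈T t≢r) (Joins-sym wt)

  _∈ᵥ?_ : (x : Fin n) (T : List (Fin n)) → Dec (x ∈ T)
  _∈ᵥ?_ = DecMembership._∈?_ _≟_

  _∖_ : List (Fin n) → List (Fin n) → List (Fin n)
  S ∖ T = filter (∁? (_∈ᵥ? T)) S

  length-∖ : ∀ {S T} → Unique S → Unique T → T ⊆ S → length (S ∖ T) + length T ≡ length S
  length-∖ {S} {T} uS uT T⊆S = begin
    length (S ∖ T) + length T    ≡⟨ cong (length (S ∖ T) +_) |T∩S|≡|T| ⟨
    length (S ∖ T) + length T∩S  ≡⟨ +-comm (length (S ∖ T)) (length T∩S) ⟩
    length T∩S + length (S ∖ T)  ≡⟨ length-filter+length-filter-∁ (_∈ᵥ? T) S ⟩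
    length S                     ∎
    where
    open ≡-Reasoning
    T∩S = filter (_∈ᵥ? T) S
    |T∩S|≡|T| : length T∩S ≡ length T
    |T∩S|≡|T| = ≤-antisym
      (⊆-length-≤ (Unique.filter⁺ (_∈ᵥ? T) uS) (λ x∈ → proj₂ (∈-filter⁻ (_∈ᵥ? T) {xs = S} x∈)))
      (⊆-length-≤ uT (λ t∈T → ∈-filter⁺ (_∈ᵥ? T) (T⊆S t∈T) t∈T))

  ∖-shorter : ∀ {S T} → Unique S → Unique T → T ⊆ S → 0 < length T → length (S ∖ T) < length S
  ∖-shorter {S} {T} uS uT T⊆S 0<|T| = subst (length (S ∖ T) <_) (length-∖ uS uT T⊆S) (m<m+n _ 0<|T|)

  Touches Inside : List (Fin n) → Edge n → Set
  Touches T e = lo e ∈ T ⊎ hi e ∈ T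
  Inside  T e = lo e ∈ T × hi e ∈ T

  touches? : ∀ T e → Dec (Touches T e)
  touches? T e = (lo e ∈ᵥ? T) ⊎-dec (hi e ∈ᵥ? T)

  inside? : ∀ T e → Dec (Inside T e)
  inside? T e = (lo e ∈ᵥ? T) ×-dec (hi e ∈ᵥ? T)

  touching inner crossing avoiding : List (Fin n) → List (Edge n) → List (Edge n)
  touching T   = filter (touches? T)
  inner    T   = filter (inside? T) ∘ touching T
  crossing T   = filter (∁? (inside? T)) ∘ touching T
  avoiding T   = filter (∁? (touches? T))

  length-partition : ∀ T X → length X ≡ length (inner T X) + length (crossing T X) + length (avoiding T X)
  length-partition T X = sym (begin
    length (inner T X) + length (crossing T X) + length (avoiding T X)
      ≡⟨ cong (_+ length (avoiding T X)) (length-filter+length-filter-∁ (inside? T) (touching T X)) ⟩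
    length (touching T X) + length (avoiding T X)
      ≡⟨ length-filter+length-filter-∁ (touches? T) X ⟩
    length X ∎)
    where open ≡-Reasoning

  avoiding-⊆ : ∀ T X → avoiding T X ⊆ X
  avoiding-⊆ T X e∈ = proj₁ (∈-filter⁻ (∁? (touches? T)) {xs = X} e∈)

  VerticesIn-avoiding : ∀ {S X} T → VerticesIn S X → VerticesIn (S ∖ T) (avoiding T X)
  VerticesIn-avoiding {X = X} T X⊆S e∈ e∋x = ∈-filter⁺ (∁? (_∈ᵥ? T)) (X⊆S e∈X e∋x) (incident∉T e∋x)
    where
    e∈X      = proj₁ (∈-filter⁻ (∁? (touches? T)) {xs = X} e∈)
    ¬touches = proj₂ (∈-filter⁻ (∁? (touches? T)) {xs = X} e∈)
    incident∉T : ∀ {x} → Incident _ x → x ∉ T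
    incident∉T lo-incident = ¬touches ∘ inj₁
    incident∉T hi-incident = ¬touches ∘ inj₂

  length-inner≤ : ∀ {T L} X → Unique X → CompleteOn T L → length (inner T X) ≤ length L
  length-inner≤ {T} {L} X uX T-complete =
    ⊆-length-≤ (Unique.filter⁺ (inside? T) (Unique.filter⁺ (touches? T) uX)) inner⊆L
    where
    inner⊆L : inner T X ⊆ L
    inner⊆L {g} g∈inner =
      let _ , lo∈T , hi∈T   = ∈-filter⁻ (inside? T) {xs = touching T X} g∈inner
          h , h∈L , h-ends = T-complete lo∈T hi∈T (lo≢hi g)
      in subst (_∈ L) (Ends-unique h-ends lo-hi) h∈L

  outerEnd : List (Fin n) → Edge n → Fin n
  outerEnd T e with lo e ∈ᵥ? T
  ... | yes _ = hi e
  ... | no  _ = lo e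

  outerEnd-crossing : ∀ T X {e} → e ∈ crossing T X →
                      e ∈ X × outerEnd T e ∉ T × Σ (Fin n) λ t → t ∈ T × Ends e t (outerEnd T e)
  outerEnd-crossing T X {e} e∈crossing with ∈-filter⁻ (∁? (inside? T)) {xs = touching T X} e∈crossing
  ... | e∈touching , ¬inside with ∈-filter⁻ (touches? T) {xs = X} e∈touching
  ...   | e∈X , touches with lo e ∈ᵥ? T | touches
  ...     | yes lo∈T | _         = e∈X , (λ hi∈T → ¬inside (lo∈T , hi∈T)) , lo e , lo∈T , lo-hi
  ...     | no  lo∉T | inj₁ lo∈T = contradiction lo∈T lo∉T
  ...     | no  lo∉T | inj₂ hi∈T = e∈X , lo∉T , hi e , hi∈T , hi-lo

  -- Two edges leaving T with the same outer end would give that end two neighbours in T.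
  length-crossing≤ : ∀ {S T X} → Unique X → VerticesIn S X → AtMostOneNeighbourIn T X →
                     length (crossing T X) ≤ length (S ∖ T)
  length-crossing≤ {S} {T} {X} uX X⊆S one-neighbour =
    injective-length-≤ (outerEnd T) (Unique.filter⁺ (∁? (inside? T)) (Unique.filter⁺ (touches? T) uX))
      outer∈S∖T outer-injective
    where
    outer∈S∖T : ∀ {g} → g ∈ crossing T X → outerEnd T g ∈ S ∖ T
    outer∈S∖T g∈ = let g∈X , outer∉T , _ , _ , g-ends = outerEnd-crossing T X g∈
                   in ∈-filter⁺ (∁? (_∈ᵥ? T)) (X⊆S g∈X (Ends⇒Incidentʳ g-ends)) outer∉T

    outer-injective : ∀ {g h} → g ∈ crossing T X → h ∈ crossing T X → outerEnd T g ≡ outerEnd T h → g ≡ h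
    outer-injective {g} {h} g∈ h∈ same-outer with outerEnd-crossing T X g∈ | outerEnd-crossing T X h∈
    ... | g∈X , w∉T , s , s∈T , g-ends | h∈X , _ , t , t∈T , h-ends
      rewrite sym same-outer with s ≟ t
    ...   | yes refl = Ends-unique g-ends h-ends
    ...   | no  s≢t  = ⊥-elim (one-neighbour w∉T s∈T t∈T s≢t
                                (g , g∈X , Ends-sym g-ends) (h , h∈X , Ends-sym h-ends))

  peel-step : ∀ (B : ℕ → ℕ) {S T L X} → (∀ t → B t + length L + t ≤ B (length T + t)) →
              Unique S → Unique T → T ⊆ S → Unique X → VerticesIn S X →
              CompleteOn T L → AtMostOneNeighbourIn T X →
              length (avoiding T X) ≤ B (length (S ∖ T)) → length X ≤ B (length S)
  peel-step B {S} {T} {L} {X} B-peel uS uT T⊆S uX X⊆S T-complete one-neighbour avoiding≤ =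
    subst (λ s → length X ≤ B s) (trans (+-comm (length T) (length (S ∖ T))) (length-∖ uS uT T⊆S))
      (peel-bound B B-peel avoiding≤ (begin
        length X                                                    ≡⟨ length-partition T X ⟩
        length (inner T X) + length (crossing T X) + length (avoiding T X)
          ≤⟨ +-monoˡ-≤ (length (avoiding T X))
               (+-mono-≤ (length-inner≤ X uX T-complete) (length-crossing≤ uX X⊆S one-neighbour)) ⟩
        length L + length (S ∖ T) + length (avoiding T X)           ≡⟨ +-comm (length L + length (S ∖ T)) _ ⟩
        length (avoiding T X) + (length L + length (S ∖ T))         ≡⟨ +-assoc (length (avoiding T X)) _ _ ⟨
        length (avoiding T X) + length L + length (S ∖ T)           ∎))
    where open ≤-Reasoning

  mantel : ∀ {S X} → Unique S → Unique X → VerticesIn S X → TriangleFree X →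
           length X ≤ quarterSquare (length S)
  mantel {S} = go (<-wellFounded (length S))
    where
    go : ∀ {S X} → Acc _<_ (length S) → Unique S → Unique X → VerticesIn S X → TriangleFree X →
         length X ≤ quarterSquare (length S)
    go {X = []} _ _ _ _ _ = z≤n
    go {S} {X@(e ∷ _)} (acc shorter) uS uX X⊆S tf =
      peel-step quarterSquare {L = e ∷ []} quarterSquare-peel-edge uS uT T⊆S uX X⊆S
        (CompleteOn-edge (e , here refl , lo-hi))
        (TriangleFree⇒AtMostOneNeighbourIn tf (CompleteOn-edge (e , here refl , lo-hi)))
        (go (shorter (∖-shorter uS uT T⊆S (s≤s z≤n)))
            (Unique.filter⁺ (∁? (_∈ᵥ? T)) uS) (Unique.filter⁺ (∁? (touches? T)) uX)
            (VerticesIn-avoiding T X⊆S) (TriangleFree-⊆ (avoiding-⊆ T X) tf))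
      where
      T = lo e ∷ hi e ∷ []
      uT : Unique T
      uT = (lo≢hi e ∷ []) ∷ [] ∷ []
      T⊆S : T ⊆ S
      T⊆S (here refl)         = X⊆S (here refl) lo-incident
      T⊆S (there (here refl)) = X⊆S (here refl) hi-incident

  diamondFree-bound : ∀ {S X} → Unique S → Unique X → VerticesIn S X → DiamondFree X →
                      length X ≤ diamondBound (length S)
  diamondFree-bound {S} = go (<-wellFounded (length S))
    where
    go : ∀ {S X} → Acc _<_ (length S) → Unique S → Unique X → VerticesIn S X → DiamondFree X →
         length X ≤ diamondBound (length S)
    go {S} {X} (acc shorter) uS uX X⊆S df with triangle-or-free X
    ... | inj₂ tf = ≤-trans (mantel uS uX X⊆S tf) (quarterSquare≤diamondBound (length S))
    ... | inj₁ (e , e∈X , w , ew@(g , g∈X , g-ends) , ew′@(g′ , _ , g′-ends)) =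
      peel-step diamondBound {L = e ∷ g ∷ g′ ∷ []} diamondBound-peel-triangle uS uT T⊆S uX X⊆S
        (CompleteOn-triangle (e , here refl , lo-hi) (g , there (here refl) , g-ends)
                             (g′ , there (there (here refl)) , g′-ends))
        (DiamondFree⇒AtMostOneNeighbourIn df uT (CompleteOn-triangle (e , e∈X , lo-hi) ew ew′))
        (go (shorter (∖-shorter uS uT T⊆S (s≤s z≤n)))
            (Unique.filter⁺ (∁? (_∈ᵥ? T)) uS) (Unique.filter⁺ (∁? (touches? T)) uX)
            (VerticesIn-avoiding T X⊆S) (DiamondFree-⊆ (avoiding-⊆ T X) df))
      where
      T = lo e ∷ hi e ∷ w ∷ []
      uT : Unique T
      uT = (lo≢hi e ∷ Joins⇒≢ ew ∷ []) ∷ (Joins⇒≢ ew′ ∷ []) ∷ [] ∷ []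
      T⊆S : T ⊆ S
      T⊆S (here refl)                 = X⊆S e∈X lo-incident
      T⊆S (there (here refl))         = X⊆S e∈X hi-incident
      T⊆S (there (there (here refl))) = X⊆S g∈X (Ends⇒Incidentʳ g-ends)

outerMV-bound : ∀ n {X : List (Edge n)} → Unique X → OuterMV (LK n) X → length X ≤ diamondBound n
outerMV-bound n {X} uX omv = subst (λ s → length X ≤ diamondBound s) (length-tabulate {n = n} id)
  (diamondFree-bound (Unique.allFin⁺ n) uX (λ _ _ → ∈-allFin _) (outerMV⇒diamondFree omv))

-- The complete bipartite construction

module CompleteBipartite (h m : ℕ) where

  Left Right : Fin (h + m) → Set
  Left  x = toℕ x < h
  Right x = h ≤ toℕ x

  crossingEdge : Fin h × Fin m → Edge (h + m)
  crossingEdge (i , j) = i ↑ˡ m , h ↑ʳ j , lo<hi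
    where
    lo<hi : toℕ (i ↑ˡ m) < toℕ (h ↑ʳ j)
    lo<hi = subst₂ _<_ (sym (toℕ-↑ˡ i m)) (sym (toℕ-↑ʳ h j)) (≤-trans (toℕ<n i) (m≤m+n h (toℕ j)))

  crossingEdge-injective : ∀ {p q} → crossingEdge p ≡ crossingEdge q → p ≡ q
  crossingEdge-injective {i , j} {i′ , j′} eq =
    cong₂ _,_ (↑ˡ-injective m i i′ (cong lo eq)) (↑ʳ-injective h j j′ (cong hi eq))

  crossingEdge-crossing : ∀ p → Left (lo (crossingEdge p)) × Right (hi (crossingEdge p))
  crossingEdge-crossing (i , j) = subst (_< h) (sym (toℕ-↑ˡ i m)) (toℕ<n i)
                                , subst (h ≤_) (sym (toℕ-↑ʳ h j)) (m≤m+n h (toℕ j))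

  remQuot-injective : ∀ {i j : Fin (h * m)} → remQuot {h} m i ≡ remQuot m j → i ≡ j
  remQuot-injective {i} {j} eq =
    trans (sym (combine-remQuot {h} m i)) (trans (cong (uncurry combine) eq) (combine-remQuot {h} m j))

  edges : List (Edge (h + m))
  edges = tabulate (crossingEdge ∘ remQuot m)

  unique-edges : Unique edges
  unique-edges = Unique.tabulate⁺ (remQuot-injective ∘ crossingEdge-injective)

  length-edges : length edges ≡ h * m
  length-edges = length-tabulate (crossingEdge ∘ remQuot m)

  edges-crossing : ∀ {e} → e ∈ edges → Left (lo e) × Right (hi e)
  edges-crossing e∈ with ∈-tabulate⁻ e∈
  ... | k , refl = crossingEdge-crossing (remQuot m k)

  one-side⇒∉edges : ∀ {g x y} → (Left x × Left y) ⊎ (Right x × Right y) → Ends g x y → g ∉ edges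
  one-side⇒∉edges (inj₁ (_ , hi-left))  lo-hi g∈ = <⇒≱ hi-left (proj₂ (edges-crossing g∈))
  one-side⇒∉edges (inj₁ (lo-left , _))  hi-lo g∈ = <⇒≱ lo-left (proj₂ (edges-crossing g∈))
  one-side⇒∉edges (inj₂ (lo-right , _)) lo-hi g∈ = <⇒≱ (proj₁ (edges-crossing g∈)) lo-right
  one-side⇒∉edges (inj₂ (_ , hi-right)) hi-lo g∈ = <⇒≱ (proj₁ (edges-crossing g∈)) hi-right

  -- f is arbitrary: if lo f is on the left go through the lower ends, otherwise both ends of f are on the right.
  visible-from-edges : ∀ {e} f → e ∈ edges → Visible (LK (h + m)) edges e f
  visible-from-edges {e} f e∈ with equal-adjacent-or-disjoint e f
  ... | inj₁ refl       = visible-refl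
  ... | inj₂ (inj₁ e~f) = visible-adjacent e~f
  ... | inj₂ (inj₂ e∥f) with toℕ (lo f) <? h
  ...   | yes lo-left  = visible-through e∥f lo-incident lo-incident
                           (one-side⇒∉edges (inj₁ (proj₁ (edges-crossing e∈) , lo-left)))
  ...   | no  lo-right = visible-through e∥f hi-incident hi-incident
                           (one-side⇒∉edges (inj₂ (proj₂ (edges-crossing e∈) , hi-right)))
    where
    hi-right : Right (hi f)
    hi-right = ≤-trans (≮⇒≥ lo-right) (<⇒≤ (proj₂ (proj₂ f)))

  outerMV-edges : OuterMV (LK (h + m)) edges
  outerMV-edges = (λ _ f e∈ _ → visible-from-edges f e∈) , (λ _ f e∈ _ → visible-from-edges f e∈)

complete-bipartite : ∀ {n} h m → h + m ≡ n →
                     Σ (List (Edge n)) λ X → Unique X × OuterMV (LK n) X × length X ≡ h * m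
complete-bipartite h m refl = edges , unique-edges , outerMV-edges , length-edges
  where open CompleteBipartite h m

corollary3p11 : ∃ λ n₀ → ∀ (n : ℕ) → n₀ ≤ n → IsMuO (LK n) (⌈ n /2⌉ * ⌊ n /2⌋)
corollary3p11 = 4 , λ n 4≤n →
    complete-bipartite ⌈ n /2⌉ ⌊ n /2⌋ (trans (+-comm ⌈ n /2⌉ ⌊ n /2⌋) (⌊n/2⌋+⌈n/2⌉≡n n))
  , λ X uX omv → subst (length X ≤_) (diamondBound-≥4 4≤n) (outerMV-bound n uX omv)
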